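{- There is a constant $D$ such that for any positive integer $n$ there exists a connected graph $G$ with $\Delta(G)\le D$ and $\mathrm{def}(G)-\mathrm{def}_c(G)\ge n$.
   Context: All graphs are finite, simple and undirected. A proper $t$-edge coloring of $G$ is a map $\alpha:E(G)\to\{1,\dots,t\}$ giving adjacent edges distinct colors. An interval coloring is a proper edge coloring in which the colors at each vertex form an interval of integers. A set $A\subseteq\{1,\dots,t\}$ is a cyclic interval modulo $t$ if $A$ or $\{1,\dots,t\}\setminus A$ is an interval of integers; a cyclic interval $t$-coloring is a proper $t$-edge coloring in which the set of colors at every vertex is a cyclic interval modulo $t$. $\mathrm{def}(G)$ (resp. $\mathrm{def}_c(G)$) is the minimum number of pendant edges whose attachment to $G$ yields a graph admitting an interval coloring (resp. a cyclic interval coloring). $\Delta(G)$ is the maximum degree. -}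

module Defs where

open import Data.Nat using (ℕ; zero; suc; _+_; _≤_)
open import Data.Bool using (Bool; true; false; if_then_else_)
open import Data.Fin using (Fin; splitAt; _≟_)
open import Data.Vec using (Vec; lookup)
open import Data.List using (List; map; allFin)
open import Data.Nat.ListAction using (sum)
open import Data.Sum using (_⊎_; inj₁; inj₂)
open import Data.Product using (Σ; ∃; ∃-syntax; _×_; _,_)
open import Relation.Nullary using (¬_; does)
open import Relation.Binary.PropositionalEquality using (_≡_; _≢_)

Adj : ℕ → Set
Adj n = Fin n → Fin n → Bool

record Graph : Set where
  field
    n     : ℕ
    adj   : Adj n
    sym   : ∀ u v → adj u v ≡ adj v u
    irrefl : ∀ v → adj v v ≡ false
open Graph public

record ProperColoring {n : ℕ} (a : Adj n) (t : ℕ) (α : Fin n → Fin n → ℕ) : Set where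
  field
    symm   : ∀ u v → a u v ≡ true → α u v ≡ α v u
    range  : ∀ u v → a u v ≡ true → 1 ≤ α u v × α u v ≤ t
    proper : ∀ v u w → a v u ≡ true → a v w ≡ true → u ≢ w → α v u ≢ α v w

ColorsAt : {n : ℕ} → Adj n → (Fin n → Fin n → ℕ) → Fin n → ℕ → Set
ColorsAt a α v c = ∃[ u ] (a v u ≡ true × α v u ≡ c)

IsInterval : (ℕ → Set) → Set
IsInterval S = ∃[ lo ] ∃[ hi ] (∀ c → (S c → lo ≤ c × c ≤ hi) × (lo ≤ c × c ≤ hi → S c))

IsCyclicInterval : ℕ → (ℕ → Set) → Set
IsCyclicInterval t S = IsInterval S ⊎ IsInterval (λ c → (1 ≤ c × c ≤ t) × ¬ S c)

IsIntervalColoring : {n : ℕ} → Adj n → ℕ → (Fin n → Fin n → ℕ) → Set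
IsIntervalColoring a t α = ProperColoring a t α × (∀ v → IsInterval (ColorsAt a α v))

IsCyclicIntervalColoring : {n : ℕ} → Adj n → ℕ → (Fin n → Fin n → ℕ) → Set
IsCyclicIntervalColoring a t α = ProperColoring a t α × (∀ v → IsCyclicInterval t (ColorsAt a α v))

IntervalColorable : {n : ℕ} → Adj n → Set
IntervalColorable a = ∃[ t ] ∃[ α ] IsIntervalColoring a t α

CyclicIntervalColorable : {n : ℕ} → Adj n → Set
CyclicIntervalColorable a = ∃[ t ] ∃[ α ] IsCyclicIntervalColoring a t α

-- Attaching m pendant edges: the j-th new vertex n + j is a leaf
-- adjacent exactly to the vertex ps[j] of G.

attach : {n m : ℕ} → Adj n → Vec (Fin n) m → Adj (n + m)
attach {n} a ps x y with splitAt n x | splitAt n y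
... | inj₁ u | inj₁ v = a u v
... | inj₁ u | inj₂ j = does (u ≟ lookup ps j)
... | inj₂ j | inj₁ v = does (v ≟ lookup ps j)
... | inj₂ _ | inj₂ _ = false

PendantInterval : Graph → ℕ → Set
PendantInterval G m = ∃[ ps ] IntervalColorable (attach {n G} {m} (adj G) ps)

PendantCyclic : Graph → ℕ → Set
PendantCyclic G m = ∃[ ps ] CyclicIntervalColorable (attach {n G} {m} (adj G) ps)

IsDef : Graph → ℕ → Set
IsDef G d = PendantInterval G d × (∀ m → PendantInterval G m → d ≤ m)

IsDefc : Graph → ℕ → Set
IsDefc G d = PendantCyclic G d × (∀ m → PendantCyclic G m → d ≤ m)

data Reach (G : Graph) : Fin (n G) → Fin (n G) → Set where
  here : ∀ {v} → Reach G v v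
  step : ∀ {u w v} → adj G u w ≡ true → Reach G w v → Reach G u v

Connected : Graph → Set
Connected G = ∀ u v → Reach G u v

degree : (G : Graph) → Fin (n G) → ℕ
degree G v = sum (map (λ u → if adj G v u then 1 else 0) (allFin (n G)))

MaxDegreeAtMost : Graph → ℕ → Set
MaxDegreeAtMost G D = ∀ v → degree G v ≤ D

-- The graph is a path of n gadgets. A gadget is K_{3,2} plus an edge inside its side of size three,
-- with a path of length two hanging from the remaining vertex of that side; consecutive gadgets are
-- joined by an edge between the end of one hanging path and the middle of the next. The maximum degree
-- is 3, a cyclic interval 4-colouring exists without any pendant edge, and one pendant edge per gadget
-- makes an interval 5-colouring possible, so def_c = 0 and def ≤ n.
-- Conversely, in an interval colouring a vertex of degree 3 sees three consecutive colours, one in each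
-- residue class modulo 3. If no pendant edge is attached to the core K_{3,2} + e of some gadget, the
-- residues of the colours properly 3-edge-colour that core, which is impossible: it has 7 edges on 5
-- vertices, while each residue class is a matching of at most 2 edges. So every gadget needs its own
-- pendant edge, and def = n.

module Submission where

open import Defs hiding (sym)
open import Data.Bool using (Bool; true; false; if_then_else_)
open import Data.Empty using (⊥; ⊥-elim)
open import Data.Fin
  using (Fin; zero; suc; toℕ; inject₁; fromℕ<; combine; remQuot; splitAt; _↑ˡ_; _↑ʳ_; _≟_)
open import Data.Fin.Properties
  using ( all?; any?; injective⇒≤; toℕ-injective; toℕ-inject₁; toℕ-fromℕ<; fromℕ<-toℕ; toℕ<n
        ; combine-injectiveˡ; combine-injectiveʳ; remQuot-combine; combine-remQuot
        ; splitAt-↑ˡ; splitAt-↑ʳ; splitAt⁻¹-↑ˡ; splitAt⁻¹-↑ʳ; ↑ˡ-injective; ↑ʳ-injective )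
open import Data.Nat using (ℕ; zero; suc; _+_; _*_; _⊔_; _≤_; _<_; _≤?_; z≤n; s≤s)
open import Data.Nat.ListAction using (sum)
open import Data.Nat.Properties
  using ( ≤-refl; ≤-reflexive; ≤-trans; <-trans; <⇒≤; <⇒≢; <-cmp; n≤1+n; n<1+n; 1+n≢n; suc-injective
        ; +-comm; +-mono-≤; +-monoˡ-≤; ⊔-comm; m≤n⇒∃[o]m+o≡n; module ≤-Reasoning )
  renaming (_<?_ to _<ℕ?_)
open import Data.List
  using (List; []; _∷_; [_]; _++_; map; upTo; applyUpTo; filter; length; replicate)
open import Data.List.Properties
  using (length-++; length-map; length-removeAt′; map-++; map-∘; map-cong; map-cong-local; ++-assoc)
open import Data.List.Membership.Propositional using (_∈_; _∉_)
open import Data.List.Membership.Propositional.Properties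
  using ( ∈-map⁺; ∈-map⁻; ∈-++⁺ˡ; ∈-++⁺ʳ; ∈-++⁻; ∈-upTo⁺; ∈-applyUpTo⁺; ∈-applyUpTo⁻
        ; ∈-filter⁺; ∈-filter⁻ )
open import Data.List.Membership.DecPropositional (Data.Nat._≟_) using (_∈?_; _∉?_)
open import Data.List.Membership.DecPropositional (_≟_ {7}) using () renaming (_∈?_ to _∈ₗ?_)
open import Data.List.Relation.Unary.All as All using (All; []; _∷_)
open import Data.List.Relation.Unary.All.Properties using (map⁺)
open import Data.List.Relation.Unary.AllPairs using ([]; _∷_)
open import Data.List.Relation.Unary.Any as Any using (Any; here; there; _─_)
open import Data.List.Relation.Unary.Unique.Propositional using (Unique)
open import Data.List.Relation.Unary.Unique.Propositional.Properties
  using (allFin⁺) renaming (map⁺ to Unique-map⁺)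
open import Data.List.Relation.Unary.Unique.DecPropositional (Data.Nat._≟_) using (unique?)
open import Data.List.Relation.Unary.Unique.DecPropositional (_≟_ {7}) using () renaming (unique? to uniqueₗ?)
open import Data.List.Relation.Unary.Unique.DecPropositional (_≟_ {3}) using () renaming (unique? to unique₃?)
open import Data.Product using (∃-syntax; Σ-syntax; _×_; _,_; proj₁; proj₂; uncurry)
open import Data.Product.Properties using (≡-dec)
open import Data.Sum using (_⊎_; inj₁; inj₂)
open import Data.Vec as Vec using (Vec; lookup)
open import Data.Vec.Properties using (lookup∘tabulate)
open import Function using (_∘_; _⇔_; mk⇔; Equivalence; case_of_; _⟨_⟩_)
open import Function.Construct.Composition using (_⇔-∘_)
open import Function.Construct.Symmetry using (⇔-sym)
open import Relation.Binary.Definitions using (tri<; tri≈; tri>)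
open import Relation.Binary.PropositionalEquality
  using (_≡_; _≢_; refl; sym; trans; cong; cong₂; subst; subst₂; ≢-sym; module ≡-Reasoning)
open import Relation.Nullary using (¬_; ¬?; Dec; yes; no; does)
open import Relation.Nullary.Decidable
  using (_×-dec_; _⊎-dec_; _→-dec_; toWitness; does-⇔; dec-true; dec-false)

open Equivalence using (to; from)

private
  variable
    S T : ℕ → Set
    x y z c : ℕ

does⇔ : {P : Set} (P? : Dec P) → does P? ≡ true ⇔ P
does⇔ (yes p) = mk⇔ (λ _ → p) (λ _ → refl)
does⇔ (no ¬p) = mk⇔ (λ ()) (⊥-elim ∘ ¬p)

∈-map-injective⁻ : {A B : Set} {f : A → B} → (∀ {u w} → f u ≡ f w → u ≡ w) →
                   ∀ {u xs} → f u ∈ map f xs → u ∈ xs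
∈-map-injective⁻ f-inj fu∈ with ∈-map⁻ _ fu∈
... | w , w∈ , eq = subst (_∈ _) (sym (f-inj eq)) w∈

map-const : {A B : Set} (b : B) (xs : List A) → map (λ _ → b) xs ≡ replicate (length xs) b
map-const b [] = refl
map-const b (_ ∷ xs) = cong (b ∷_) (map-const b xs)

count : {A : Set} → (A → Bool) → List A → ℕ
count f xs = sum (map (λ x → if f x then 1 else 0) xs)

∈-─ : {A : Set} {x w : A} {ys : List A} (x∈ys : x ∈ ys) → w ∈ ys → w ≢ x → w ∈ (ys ─ x∈ys)
∈-─ (here refl) (here refl) w≢x = ⊥-elim (w≢x refl)
∈-─ (here refl) (there w∈ys) _ = w∈ys
∈-─ (there x∈ys) (here refl) _ = here refl
∈-─ (there x∈ys) (there w∈ys) w≢x = there (∈-─ x∈ys w∈ys w≢x)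

count≤length : {A : Set} (f : A → Bool) {xs ys : List A} → Unique xs →
               (∀ {x} → x ∈ xs → f x ≡ true → x ∈ ys) → count f xs ≤ length ys
count≤length f [] _ = z≤n
count≤length f {x ∷ xs} {ys} (x∉xs ∷ unique) sub with f x in fx
... | false = count≤length f unique (sub ∘ there)
... | true = subst (suc (count f xs) ≤_) (sym (length-removeAt′ ys (Any.index x∈ys)))
                   (s≤s (count≤length f unique sub′))
  where
  x∈ys : x ∈ ys
  x∈ys = sub (here refl) fx
  sub′ : ∀ {w} → w ∈ xs → f w ≡ true → w ∈ (ys ─ x∈ys)
  sub′ w∈xs fw = ∈-─ x∈ys (sub (there w∈xs) fw) (≢-sym (All.lookup x∉xs w∈xs))

Unique-map⇒injective : {A B : Set} (f : A → B) {xs : List A} {u w : A} →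
                       Unique (map f xs) → u ∈ xs → w ∈ xs → f u ≡ f w → u ≡ w
Unique-map⇒injective f _ (here refl) (here refl) _ = refl
Unique-map⇒injective f (fresh ∷ _) (here refl) (there w∈) eq =
  ⊥-elim (All.lookup fresh (∈-map⁺ f w∈) eq)
Unique-map⇒injective f (fresh ∷ _) (there u∈) (here refl) eq =
  ⊥-elim (All.lookup fresh (∈-map⁺ f u∈) (sym eq))
Unique-map⇒injective f (_ ∷ unique) (there u∈) (there w∈) eq =
  Unique-map⇒injective f unique u∈ w∈ eq

-- Intervals and residues modulo 3

IsInterval-resp : (∀ c → S c ⇔ T c) → IsInterval S → IsInterval T
IsInterval-resp S⇔T (lo , hi , I) =
  lo , hi , λ c → proj₁ (I c) ∘ from (S⇔T c) , to (S⇔T c) ∘ proj₂ (I c)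

IsCyclicInterval-resp : ∀ t → (∀ c → S c ⇔ T c) → IsCyclicInterval t S → IsCyclicInterval t T
IsCyclicInterval-resp t S⇔T (inj₁ I) = inj₁ (IsInterval-resp S⇔T I)
IsCyclicInterval-resp {S} {T} t S⇔T (inj₂ I) = inj₂ (IsInterval-resp complement I)
  where
  complement : ∀ c → ((1 ≤ c × c ≤ t) × ¬ S c) ⇔ ((1 ≤ c × c ≤ t) × ¬ T c)
  complement c = mk⇔ (λ (b , ¬S) → b , ¬S ∘ from (S⇔T c)) (λ (b , ¬T) → b , ¬T ∘ to (S⇔T c))

interval-convex : IsInterval S → S x → S y → x ≤ c → c ≤ y → S c
interval-convex {c = c} (lo , hi , I) Sx Sy x≤c c≤y =
  proj₂ (I c) (≤-trans (proj₁ (proj₁ (I _) Sx)) x≤c , ≤-trans c≤y (proj₂ (proj₁ (I _) Sy)))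

-- The end points of a non-empty interval are among its elements, which makes this decidable.
IntervalList : List ℕ → Set
IntervalList cs =
  Any (λ lo → Any (λ hi → All (λ c → lo ≤ c × c ≤ hi) cs ×
                          All (λ c → lo ≤ c → c ∈ cs) (upTo (suc hi))) cs) cs

IntervalList⇒IsInterval : ∀ {cs} → IntervalList cs → IsInterval (_∈ cs)
IntervalList⇒IsInterval {cs} I with Any.satisfied I
... | lo , J with Any.satisfied J
...   | hi , bounded , complete =
  lo , hi , λ c → All.lookup bounded ,
                  λ (lo≤c , c≤hi) → All.lookup complete (∈-upTo⁺ (s≤s c≤hi)) lo≤c

intervalList? : ∀ cs → Dec (IntervalList cs)
intervalList? cs = Any.any? (λ lo → Any.any? (λ hi →
  All.all? (λ c → lo ≤? c ×-dec c ≤? hi) cs ×-dec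
  All.all? (λ c → lo ≤? c →-dec c ∈? cs) (upTo (suc hi))) cs) cs

complementList : ℕ → List ℕ → List ℕ
complementList t cs = filter (_∉? cs) (applyUpTo suc t)

∈-complementList : ∀ t cs c → c ∈ complementList t cs ⇔ ((1 ≤ c × c ≤ t) × c ∉ cs)
∈-complementList t cs c = mk⇔ into out
  where
  into : c ∈ complementList t cs → (1 ≤ c × c ≤ t) × c ∉ cs
  into c∈ with ∈-filter⁻ (_∉? cs) {xs = applyUpTo suc t} c∈
  ... | c∈range , c∉ with ∈-applyUpTo⁻ suc {n = t} c∈range
  ...   | i , i<t , refl = (s≤s z≤n , i<t) , c∉
  out : (1 ≤ c × c ≤ t) × c ∉ cs → c ∈ complementList t cs
  out ((s≤s {n = i} _ , c≤t) , c∉) =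
    ∈-filter⁺ (_∉? cs) {xs = applyUpTo suc t} (∈-applyUpTo⁺ suc {n = t} c≤t) c∉

CyclicIntervalList : ℕ → List ℕ → Set
CyclicIntervalList t cs = IntervalList cs ⊎ IntervalList (complementList t cs)

CyclicIntervalList⇒IsCyclicInterval : ∀ t {cs} → CyclicIntervalList t cs → IsCyclicInterval t (_∈ cs)
CyclicIntervalList⇒IsCyclicInterval t (inj₁ I) = inj₁ (IntervalList⇒IsInterval I)
CyclicIntervalList⇒IsCyclicInterval t {cs} (inj₂ I) =
  inj₂ (IsInterval-resp (∈-complementList t cs) (IntervalList⇒IsInterval I))

cyclicIntervalList? : ∀ t cs → Dec (CyclicIntervalList t cs)
cyclicIntervalList? t cs = intervalList? cs ⊎-dec intervalList? (complementList t cs)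

residue : ℕ → Fin 3
residue 0 = zero
residue 1 = suc zero
residue 2 = suc (suc zero)
residue (suc (suc (suc x))) = residue x

residue-gap : ∀ x d → residue x ≡ residue (suc x + d) → 2 ≤ d
residue-gap x (suc (suc d)) _ = s≤s (s≤s z≤n)
residue-gap 0 0 ()
residue-gap 0 1 ()
residue-gap 1 0 ()
residue-gap 1 1 ()
residue-gap 2 0 ()
residue-gap 2 1 ()
residue-gap (suc (suc (suc x))) d eq = residue-gap x d eq

congruent⇒3+≤ : x < y → residue x ≡ residue y → 3 + x ≤ y
congruent⇒3+≤ {x} x<y eq with m≤n⇒∃[o]m+o≡n x<y
... | d , refl = s≤s (subst (2 + x ≤_) (+-comm d x) (+-monoˡ-≤ x (residue-gap x d eq)))

private
  -- Congruent colours x < y enclose x + 1 and x + 2, two further colours of S.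
  enclosing : IsInterval S → S x → S y → x < y →
              (∀ c → S c → c ≢ x → c ≢ y → c ≡ z) → residue x ≢ residue y
  enclosing {S} {x} {y} I Sx Sy x<y third eq =
    1+x≢2+x (trans (third (1 + x) S[1+x] (≢-sym (<⇒≢ x<1+x)) (<⇒≢ 1+x<y))
                  (sym (third (2 + x) S[2+x] (≢-sym (<⇒≢ x<2+x)) (<⇒≢ 2+x<y))))
    where
    2+x<y : 2 + x < y
    2+x<y = congruent⇒3+≤ x<y eq
    1+x<y : 1 + x < y
    1+x<y = ≤-trans (n≤1+n _) 2+x<y
    x<1+x : x < 1 + x
    x<1+x = n<1+n x
    x<2+x : x < 2 + x
    x<2+x = ≤-trans x<1+x (n≤1+n _)
    1+x≢2+x : 1 + x ≢ 2 + x
    1+x≢2+x = <⇒≢ (n<1+n (1 + x))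
    S[1+x] : S (1 + x)
    S[1+x] = interval-convex I Sx Sy (<⇒≤ x<1+x) (<⇒≤ 1+x<y)
    S[2+x] : S (2 + x)
    S[2+x] = interval-convex I Sx Sy (<⇒≤ x<2+x) (<⇒≤ 2+x<y)

interval-residues : IsInterval S → S x → S y → x ≢ y →
                    (∀ c → S c → c ≢ x → c ≢ y → c ≡ z) → residue x ≢ residue y
interval-residues {x = x} {y = y} I Sx Sy x≢y third with <-cmp x y
... | tri< x<y _ _ = enclosing I Sx Sy x<y third
... | tri≈ _ x≡y _ = ⊥-elim (x≢y x≡y)
... | tri> _ _ y<x = enclosing I Sy Sx y<x (λ c Sc c≢y c≢x → third c Sc c≢x c≢y) ∘ sym

three-colour-residues : IsInterval S → (∀ c → S c ⇔ c ∈ x ∷ y ∷ z ∷ []) →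
                        Unique (x ∷ y ∷ z ∷ []) → Unique (map residue (x ∷ y ∷ z ∷ []))
three-colour-residues {S} {x} {y} {z} I S⇔ ((x≢y ∷ x≢z ∷ []) ∷ (y≢z ∷ []) ∷ [] ∷ []) =
  (interval-residues I Sx Sy x≢y (λ c Sc → proj₁ (other Sc)) ∷
   interval-residues I Sx Sz x≢z (λ c Sc → proj₁ (proj₂ (other Sc))) ∷ []) ∷
  (interval-residues I Sy Sz y≢z (λ c Sc → proj₂ (proj₂ (other Sc))) ∷ []) ∷ [] ∷ []
  where
  Sx : S x
  Sx = from (S⇔ x) (here refl)
  Sy : S y
  Sy = from (S⇔ y) (there (here refl))
  Sz : S z
  Sz = from (S⇔ z) (there (there (here refl)))
  other : ∀ {c} → S c →
          (c ≢ x → c ≢ y → c ≡ z) × (c ≢ x → c ≢ z → c ≡ y) × (c ≢ y → c ≢ z → c ≡ x)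
  other {c} Sc with to (S⇔ c) Sc
  ... | here refl =
    (λ c≢x _ → ⊥-elim (c≢x refl)) , (λ c≢x _ → ⊥-elim (c≢x refl)) , (λ _ _ → refl)
  ... | there (here refl) =
    (λ _ c≢y → ⊥-elim (c≢y refl)) , (λ _ _ → refl) , (λ c≢y _ → ⊥-elim (c≢y refl))
  ... | there (there (here refl)) =
    (λ _ _ → refl) , (λ _ c≢z → ⊥-elim (c≢z refl)) , (λ _ c≢z → ⊥-elim (c≢z refl))

Rainbow : ℕ → (List ℕ → Set) → List ℕ → Set
Rainbow t Shape cs = Unique cs × All (λ c → 1 ≤ c × c ≤ t) cs × Shape cs

rainbow? : ∀ t {Shape : List ℕ → Set} → (∀ cs → Dec (Shape cs)) → ∀ cs → Dec (Rainbow t Shape cs)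
rainbow? t shape? cs = unique? cs ×-dec All.all? (λ c → 1 ≤? c ×-dec c ≤? t) cs ×-dec shape? cs

module _ {M : ℕ} (a : Adj M) where

  Neighbourhood : Fin M → List (Fin M) → Set
  Neighbourhood v nb = ∀ y → a v y ≡ true ⇔ y ∈ nb

  colours-at : ∀ (α : Fin M → Fin M → ℕ) {v nb} → Neighbourhood v nb →
               ∀ c → ColorsAt a α v c ⇔ c ∈ map (α v) nb
  colours-at α {v} N c = mk⇔
    (λ (u , avu , αvu≡c) → subst (_∈ _) αvu≡c (∈-map⁺ (α v) (to (N u) avu)))
    (λ c∈ → let (u , u∈ , c≡αvu) = ∈-map⁻ (α v) c∈ in u , from (N u) u∈ , sym c≡αvu)

  proper-rainbow : ∀ {t α v nb} → ProperColoring a t α → All (λ u → a v u ≡ true) nb → Unique nb →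
                   Unique (map (α v) nb)
  proper-rainbow P [] [] = []
  proper-rainbow {v = v} P (avu ∷ avs) (u∉ ∷ unique) =
    map⁺ (All.zipWith (λ (avw , u≢w) → ProperColoring.proper P v _ _ avu avw u≢w) (avs , u∉)) ∷
    proper-rainbow P avs unique

  record Star (t : ℕ) (α : Fin M → Fin M → ℕ) (v : Fin M) : Set where
    field
      nb            : List (Fin M)
      neighbourhood : Neighbourhood v nb
      rainbow       : Unique (map (α v) nb)
      bounded       : All (λ c → 1 ≤ c × c ≤ t) (map (α v) nb)

  module _ {t : ℕ} {α : Fin M → Fin M → ℕ} where

    star : ∀ {v} {Shape : List ℕ → Set} nb → Neighbourhood v nb → Rainbow t Shape (map (α v) nb) →
           Σ[ s ∈ Star t α v ] Shape (map (α v) (Star.nb s))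
    star nb N (rainbow , bounded , shape) =
      record { nb = nb ; neighbourhood = N ; rainbow = rainbow ; bounded = bounded } , shape

    stars⇒proper : (∀ u v → α u v ≡ α v u) → (∀ v → Star t α v) → ProperColoring a t α
    stars⇒proper α-sym star = record
      { symm   = λ u v _ → α-sym u v
      ; range  = λ v u avu →
                   All.lookup (bounded (star v)) (∈-map⁺ (α v) (to (neighbourhood (star v) u) avu))
      ; proper = λ v u w avu avw u≢w → u≢w ∘ Unique-map⇒injective (α v) (rainbow (star v))
                   (to (neighbourhood (star v) u) avu) (to (neighbourhood (star v) w) avw)
      }
      where open Star

    star⇒interval : ∀ {v} (s : Star t α v) → IntervalList (map (α v) (Star.nb s)) →
                    IsInterval (ColorsAt a α v)
    star⇒interval s I =
      IsInterval-resp (λ c → ⇔-sym (colours-at α (Star.neighbourhood s) c)) (IntervalList⇒IsInterval I)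

    star⇒cyclic : ∀ {v} (s : Star t α v) → CyclicIntervalList t (map (α v) (Star.nb s)) →
                  IsCyclicInterval t (ColorsAt a α v)
    star⇒cyclic s I =
      IsCyclicInterval-resp t (λ c → ⇔-sym (colours-at α (Star.neighbourhood s) c))
        (CyclicIntervalList⇒IsCyclicInterval t I)

degree≤ : ∀ G {v nb} → Neighbourhood (adj G) v nb → degree G v ≤ length nb
degree≤ G {v} N = count≤length (adj G v) (allFin⁺ (n G)) (λ {u} _ avu → to (N u) avu)

data Side (M m : ℕ) : Fin (M + m) → Set where
  old : (u : Fin M) → Side M m (u ↑ˡ m)
  new : (j : Fin m) → Side M m (M ↑ʳ j)

side : ∀ M {m} x → Side M m x
side M {m} x with splitAt M x in eq
... | inj₁ u = subst (Side M m) (splitAt⁻¹-↑ˡ eq) (old u)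
... | inj₂ j = subst (Side M m) (splitAt⁻¹-↑ʳ eq) (new j)

↑ˡ≢↑ʳ : ∀ {M m} (u : Fin M) (j : Fin m) → u ↑ˡ m ≢ M ↑ʳ j
↑ˡ≢↑ʳ {M} {m} u j eq
  with () ← trans (sym (splitAt-↑ˡ M u m)) (trans (cong (splitAt M) eq) (splitAt-↑ʳ M m j))

module Pendants {M m : ℕ} (a : Adj M) (ps : Vec (Fin M) m) where

  attach-old-old : ∀ u v → attach a ps (u ↑ˡ m) (v ↑ˡ m) ≡ a u v
  attach-old-old u v rewrite splitAt-↑ˡ M u m | splitAt-↑ˡ M v m = refl

  attach-old-new : ∀ u j → attach a ps (u ↑ˡ m) (M ↑ʳ j) ≡ true ⇔ u ≡ lookup ps j
  attach-old-new u j rewrite splitAt-↑ˡ M u m | splitAt-↑ʳ M m j = does⇔ (u ≟ lookup ps j)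

  attach-new-old : ∀ j v → attach a ps (M ↑ʳ j) (v ↑ˡ m) ≡ true ⇔ v ≡ lookup ps j
  attach-new-old j v rewrite splitAt-↑ʳ M m j | splitAt-↑ˡ M v m = does⇔ (v ≟ lookup ps j)

  attach-new-new : ∀ j k → attach a ps (M ↑ʳ j) (M ↑ʳ k) ≡ false
  attach-new-new j k rewrite splitAt-↑ʳ M m j | splitAt-↑ʳ M m k = refl

  old-neighbourhood : ∀ {u nb} {pl : List (Fin m)} → Neighbourhood a u nb →
                      (∀ j → j ∈ pl ⇔ u ≡ lookup ps j) →
                      Neighbourhood (attach a ps) (u ↑ˡ m) (map (_↑ˡ m) nb ++ map (M ↑ʳ_) pl)
  old-neighbourhood {u} {nb} {pl} N P y with side M y
  ... | old v = mk⇔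
    (∈-++⁺ˡ ∘ ∈-map⁺ (_↑ˡ m) ∘ to (N v) ∘ subst (_≡ true) (attach-old-old u v))
    (subst (_≡ true) (sym (attach-old-old u v)) ∘ from (N v) ∘ old∈ ∘ ∈-++⁻ (map (_↑ˡ m) nb))
    where
    old∈ : v ↑ˡ m ∈ map (_↑ˡ m) nb ⊎ v ↑ˡ m ∈ map (M ↑ʳ_) pl → v ∈ nb
    old∈ (inj₁ v∈) = ∈-map-injective⁻ (↑ˡ-injective m _ _) v∈
    old∈ (inj₂ v∈) with ∈-map⁻ (M ↑ʳ_) v∈
    ... | j , _ , eq = ⊥-elim (↑ˡ≢↑ʳ v j eq)
  ... | new j = mk⇔
    (∈-++⁺ʳ (map (_↑ˡ m) nb) ∘ ∈-map⁺ (M ↑ʳ_) ∘ from (P j) ∘ to (attach-old-new u j))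
    (from (attach-old-new u j) ∘ to (P j) ∘ new∈ ∘ ∈-++⁻ (map (_↑ˡ m) nb))
    where
    new∈ : M ↑ʳ j ∈ map (_↑ˡ m) nb ⊎ M ↑ʳ j ∈ map (M ↑ʳ_) pl → j ∈ pl
    new∈ (inj₁ j∈) with ∈-map⁻ (_↑ˡ m) j∈
    ... | v , _ , eq = ⊥-elim (↑ˡ≢↑ʳ v j (sym eq))
    new∈ (inj₂ j∈) = ∈-map-injective⁻ (↑ʳ-injective M _ _) j∈

  new-neighbourhood : ∀ j → Neighbourhood (attach a ps) (M ↑ʳ j) [ lookup ps j ↑ˡ m ]
  new-neighbourhood j y with side M y
  ... | old v = mk⇔
    (here ∘ cong (_↑ˡ m) ∘ to (attach-new-old j v))
    (λ { (here eq) → from (attach-new-old j v) (↑ˡ-injective m _ _ eq) ; (there ()) })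
  ... | new k = mk⇔
    (λ e → case trans (sym e) (attach-new-new j k) of λ ())
    (λ { (here eq) → ⊥-elim (↑ˡ≢↑ʳ _ k (sym eq)) ; (there ()) })

-- The chain of gadgets

Label : Set
Label = Fin 7

pattern l0 = zero
pattern l1 = suc zero
pattern l2 = suc (suc zero)
pattern l3 = suc (suc (suc zero))
pattern l4 = suc (suc (suc (suc zero)))
pattern l5 = suc (suc (suc (suc (suc zero))))
pattern l6 = suc (suc (suc (suc (suc (suc zero)))))

-- The gadget: K_{3,2} on {l0, l1, l2} and {l3, l4}, the edge l1 l2, and the path l0 l5 l6.
gadgetNbrs : Label → List Label
gadgetNbrs l0 = l3 ∷ l4 ∷ l5 ∷ []
gadgetNbrs l1 = l2 ∷ l3 ∷ l4 ∷ []
gadgetNbrs l2 = l1 ∷ l3 ∷ l4 ∷ []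
gadgetNbrs l3 = l0 ∷ l1 ∷ l2 ∷ []
gadgetNbrs l4 = l0 ∷ l1 ∷ l2 ∷ []
gadgetNbrs l5 = l0 ∷ l6 ∷ []
gadgetNbrs l6 = l5 ∷ []

gadget-sym : ∀ a b → b ∈ gadgetNbrs a → a ∈ gadgetNbrs b
gadget-sym =
  toWitness {a? = all? λ a → all? λ b → b ∈ₗ? gadgetNbrs a →-dec a ∈ₗ? gadgetNbrs b} _

gadget-irrefl : ∀ a → a ∉ gadgetNbrs a
gadget-irrefl = toWitness {a? = all? λ a → ¬? (a ∈ₗ? gadgetNbrs a)} _

predecessor : ∀ {n} → Fin n → List (Fin n)
predecessor zero = []
predecessor (suc i) = [ inject₁ i ]

∈-predecessor : ∀ {n} {i j : Fin n} → j ∈ predecessor i ⇔ suc (toℕ j) ≡ toℕ i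
∈-predecessor {i = zero} = mk⇔ (λ ()) (λ ())
∈-predecessor {i = suc i} = mk⇔
  (λ { (here refl) → cong suc (toℕ-inject₁ i) })
  (λ eq → here (toℕ-injective (trans (suc-injective eq) (sym (toℕ-inject₁ i)))))

successor : ∀ {n} → Fin n → List (Fin n)
successor {n} i with suc (toℕ i) <ℕ? n
... | yes i+1<n = [ fromℕ< i+1<n ]
... | no _ = []

∈-successor : ∀ {n} {i j : Fin n} → j ∈ successor i ⇔ toℕ j ≡ suc (toℕ i)
∈-successor {n} {i} {j} with suc (toℕ i) <ℕ? n
... | yes i+1<n = mk⇔ (λ { (here refl) → toℕ-fromℕ< i+1<n })
                      (λ eq → here (toℕ-injective (trans eq (sym (toℕ-fromℕ< i+1<n)))))
... | no i+1≮n = mk⇔ (λ ()) (λ eq → ⊥-elim (i+1≮n (subst (_< n) eq (toℕ<n j))))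

Vertex : ℕ → Set
Vertex n = Fin n × Label

links : ∀ {n} → Vertex n → List (Vertex n)
links (i , l5) = map (_, l6) (predecessor i)
links (i , l6) = map (_, l5) (successor i)
links (i , _) = []

neighbours : ∀ {n} → Vertex n → List (Vertex n)
neighbours (i , a) = map (i ,_) (gadgetNbrs a) ++ links (i , a)

links-sym : ∀ {n} {x y : Vertex n} → y ∈ links x → x ∈ links y
links-sym {x = i , l5} y∈ with ∈-map⁻ (_, l6) y∈
... | j , j∈ , refl = ∈-map⁺ (_, l5) (from ∈-successor (sym (to ∈-predecessor j∈)))
links-sym {x = i , l6} y∈ with ∈-map⁻ (_, l5) y∈
... | j , j∈ , refl = ∈-map⁺ (_, l6) (from ∈-predecessor (sym (to ∈-successor j∈)))

neighbours-sym : ∀ {n} {x y : Vertex n} → y ∈ neighbours x → x ∈ neighbours y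
neighbours-sym {x = i , a} y∈ with ∈-++⁻ (map (i ,_) (gadgetNbrs a)) y∈
... | inj₂ y∈links = ∈-++⁺ʳ _ (links-sym y∈links)
... | inj₁ y∈gadget with ∈-map⁻ (i ,_) y∈gadget
...   | b , b∈ , refl = ∈-++⁺ˡ (∈-map⁺ (i ,_) (gadget-sym a b b∈))

links-irrefl : ∀ {n} {x : Vertex n} → x ∉ links x
links-irrefl {x = i , l5} x∈ with ∈-map⁻ (_, l6) x∈
... | _ , _ , ()
links-irrefl {x = i , l6} x∈ with ∈-map⁻ (_, l5) x∈
... | _ , _ , ()

neighbours-irrefl : ∀ {n} {x : Vertex n} → x ∉ neighbours x
neighbours-irrefl {x = i , a} x∈ with ∈-++⁻ (map (i ,_) (gadgetNbrs a)) x∈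
... | inj₁ x∈gadget = gadget-irrefl a (∈-map-injective⁻ (cong proj₂) x∈gadget)
... | inj₂ x∈links = links-irrefl x∈links

module _ {n : ℕ} where

  _≟ᵥ_ : (x y : Vertex n) → Dec (x ≡ y)
  _≟ᵥ_ = ≡-dec _≟_ _≟_

  open import Data.List.Membership.DecPropositional _≟ᵥ_ using () renaming (_∈?_ to _∈ᵥ?_)

  adjacent : Vertex n → Vertex n → Bool
  adjacent x y = does (y ∈ᵥ? neighbours x)

  adjacent⇔ : ∀ x y → adjacent x y ≡ true ⇔ y ∈ neighbours x
  adjacent⇔ x y = does⇔ (y ∈ᵥ? neighbours x)

  adjacent-sym : ∀ x y → adjacent x y ≡ adjacent y x
  adjacent-sym x y =
    does-⇔ (mk⇔ neighbours-sym neighbours-sym) (y ∈ᵥ? neighbours x) (x ∈ᵥ? neighbours y)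

  adjacent-irrefl : ∀ x → adjacent x x ≡ false
  adjacent-irrefl x = dec-false (x ∈ᵥ? neighbours x) neighbours-irrefl

  encode : Vertex n → Fin (n * 7)
  encode (i , a) = combine i a

  decode : Fin (n * 7) → Vertex n
  decode = remQuot 7

  decode-encode : ∀ x → decode (encode x) ≡ x
  decode-encode (i , a) = remQuot-combine i a

  encode-decode : ∀ u → encode (decode u) ≡ u
  encode-decode = combine-remQuot {n} 7

  encode-injective : ∀ {x x′} → encode x ≡ encode x′ → x ≡ x′
  encode-injective {x} {x′} eq = trans (sym (decode-encode x)) (trans (cong decode eq) (decode-encode x′))

  ∈-map-encode : ∀ {u xs} → decode u ∈ xs ⇔ u ∈ map encode xs
  ∈-map-encode {u} = mk⇔ (subst (_∈ _) (encode-decode u) ∘ ∈-map⁺ encode)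
                         (∈-map-injective⁻ encode-injective ∘ subst (_∈ _) (sym (encode-decode u)))

chain : ℕ → Graph
chain n = record
  { n      = n * 7
  ; adj    = λ u v → adjacent {n} (decode u) (decode v)
  ; sym    = λ u v → adjacent-sym {n} (decode u) (decode v)
  ; irrefl = λ u → adjacent-irrefl {n} (decode u)
  }

chain-neighbourhood : ∀ {n} u → Neighbourhood (adj (chain n)) u (map encode (neighbours (decode u)))
chain-neighbourhood {n} u y = ∈-map-encode ⇔-∘ adjacent⇔ {n} (decode u) (decode y)

chain-neighbourhood′ : ∀ {n} (x : Vertex n) →
                       Neighbourhood (adj (chain n)) (encode x) (map encode (neighbours x))
chain-neighbourhood′ {n} x =
  subst (λ w → Neighbourhood (adj (chain n)) (encode x) (map encode (neighbours w)))
        (decode-encode x) (chain-neighbourhood (encode x))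

linkBound : Label → ℕ
linkBound l5 = 1
linkBound l6 = 1
linkBound _ = 0

links-length : ∀ {n} (x : Vertex n) → length (links x) ≤ linkBound (proj₂ x)
links-length (i , l0) = z≤n
links-length (i , l1) = z≤n
links-length (i , l2) = z≤n
links-length (i , l3) = z≤n
links-length (i , l4) = z≤n
links-length (zero , l5) = z≤n
links-length (suc i , l5) = s≤s z≤n
links-length {n} (i , l6) with suc (toℕ i) <ℕ? n
... | yes _ = s≤s z≤n
... | no _ = z≤n

links-elsewhere : ∀ {n} {i : Fin n} {a y} → y ∈ links (i , a) → proj₁ y ≢ i
links-elsewhere {a = l5} y∈ with ∈-map⁻ (_, l6) y∈
... | j , j∈ , refl = λ j≡i → 1+n≢n (trans (to ∈-predecessor j∈) (cong toℕ (sym j≡i)))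
links-elsewhere {a = l6} y∈ with ∈-map⁻ (_, l5) y∈
... | j , j∈ , refl = λ j≡i → 1+n≢n (trans (sym (to ∈-successor j∈)) (cong toℕ j≡i))

-- Colourings of the chain

module ChainColouring {n : ℕ} (CL : Label → Label → ℕ) (CL-sym : ∀ a b → CL a b ≡ CL b a)
                      (linkColour pendantColour : ℕ)
                      {m : ℕ} (ps : Vec (Fin (n * 7)) m) (pendantsOf : Vertex n → List (Fin m))
                      (∈-pendantsOf : ∀ x j → j ∈ pendantsOf x ⇔ encode x ≡ lookup ps j)
                      (pendantCount : Label → ℕ)
                      (pendants-length : ∀ x → length (pendantsOf x) ≡ pendantCount (proj₂ x))
                      where

  open ≡-Reasoning

  κ : Vertex n → Vertex n → ℕ
  κ (i , a) (j , b) = if does (i ≟ j) then CL a b else linkColour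

  κ-sym : ∀ x y → κ x y ≡ κ y x
  κ-sym (i , a) (j , b) with i ≟ j | j ≟ i
  ... | yes refl | yes _ = CL-sym a b
  ... | yes refl | no j≢i = ⊥-elim (j≢i refl)
  ... | no i≢j | yes refl = ⊥-elim (i≢j refl)
  ... | no _ | no _ = refl

  M : ℕ
  M = n * 7

  -- decode at this n; n cannot be inferred from Fin (n * 7).
  vertexOf : Fin M → Vertex n
  vertexOf = decode

  -- The colour 0 of two pendant vertices is junk: they are never adjacent.
  colourSides : Fin M ⊎ Fin m → Fin M ⊎ Fin m → ℕ
  colourSides (inj₁ u) (inj₁ v) = κ (vertexOf u) (vertexOf v)
  colourSides (inj₁ _) (inj₂ _) = pendantColour
  colourSides (inj₂ _) (inj₁ _) = pendantColour
  colourSides (inj₂ _) (inj₂ _) = 0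

  α : Fin (M + m) → Fin (M + m) → ℕ
  α x y = colourSides (splitAt M x) (splitAt M y)

  α-sym : ∀ x y → α x y ≡ α y x
  α-sym x y with splitAt M x | splitAt M y
  ... | inj₁ u | inj₁ v = κ-sym (vertexOf u) (vertexOf v)
  ... | inj₁ _ | inj₂ _ = refl
  ... | inj₂ _ | inj₁ _ = refl
  ... | inj₂ _ | inj₂ _ = refl

  α-old-old : ∀ u v → α (u ↑ˡ m) (v ↑ˡ m) ≡ κ (vertexOf u) (vertexOf v)
  α-old-old u v rewrite splitAt-↑ˡ M u m | splitAt-↑ˡ M v m = refl

  α-old-new : ∀ u j → α (u ↑ˡ m) (M ↑ʳ j) ≡ pendantColour
  α-old-new u j rewrite splitAt-↑ˡ M u m | splitAt-↑ʳ M m j = refl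

  α-new-old : ∀ j v → α (M ↑ʳ j) (v ↑ˡ m) ≡ pendantColour
  α-new-old j v rewrite splitAt-↑ʳ M m j | splitAt-↑ˡ M v m = refl

  profile : Label → ℕ → ℕ → List ℕ
  profile a k p = map (CL a) (gadgetNbrs a) ++ replicate k linkColour ++ replicate p pendantColour

  neighbour-colours : ∀ x → map (κ x) (neighbours x) ≡
                      map (CL (proj₂ x)) (gadgetNbrs (proj₂ x)) ++ replicate (length (links x)) linkColour
  neighbour-colours (i , a) = begin
    map (κ (i , a)) (map (i ,_) (gadgetNbrs a) ++ links (i , a))
      ≡⟨ map-++ (κ (i , a)) (map (i ,_) (gadgetNbrs a)) (links (i , a)) ⟩
    map (κ (i , a)) (map (i ,_) (gadgetNbrs a)) ++ map (κ (i , a)) (links (i , a))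
      ≡⟨ cong₂ _++_ gadget-part link-part ⟩
    map (CL a) (gadgetNbrs a) ++ replicate (length (links (i , a))) linkColour ∎
    where
    same-gadget : ∀ b → κ (i , a) (i , b) ≡ CL a b
    same-gadget b rewrite dec-true (i ≟ i) refl = refl
    other-gadget : ∀ {y} → y ∈ links (i , a) → κ (i , a) y ≡ linkColour
    other-gadget {j , b} y∈ rewrite dec-false (i ≟ j) (links-elsewhere {a = a} y∈ ∘ sym) = refl
    gadget-part : map (κ (i , a)) (map (i ,_) (gadgetNbrs a)) ≡ map (CL a) (gadgetNbrs a)
    gadget-part = trans (sym (map-∘ (gadgetNbrs a))) (map-cong same-gadget (gadgetNbrs a))
    link-part : map (κ (i , a)) (links (i , a)) ≡ replicate (length (links (i , a))) linkColour
    link-part = trans (map-cong-local (All.tabulate other-gadget)) (map-const linkColour (links (i , a)))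

  oldNbrs : Fin M → List (Fin (M + m))
  oldNbrs u =
    map (_↑ˡ m) (map encode (neighbours (vertexOf u))) ++ map (M ↑ʳ_) (pendantsOf (vertexOf u))

  old-colours : ∀ u → let x = vertexOf u in
                map (α (u ↑ˡ m)) (oldNbrs u) ≡ profile (proj₂ x) (length (links x)) (pendantCount (proj₂ x))
  old-colours u = begin
    map (α (u ↑ˡ m)) (oldNbrs u)
      ≡⟨ map-++ (α (u ↑ˡ m)) (map (_↑ˡ m) (map encode ns)) (map (M ↑ʳ_) pl) ⟩
    map (α (u ↑ˡ m)) (map (_↑ˡ m) (map encode ns)) ++ map (α (u ↑ˡ m)) (map (M ↑ʳ_) pl)
      ≡⟨ cong₂ _++_ chain-part pendant-part ⟩
    map (κ w) ns ++ replicate (pendantCount (proj₂ w)) pendantColour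
      ≡⟨ cong (_++ replicate (pendantCount (proj₂ w)) pendantColour) (neighbour-colours w) ⟩
    (map (CL (proj₂ w)) (gadgetNbrs (proj₂ w)) ++ replicate (length (links w)) linkColour) ++ _
      ≡⟨ ++-assoc (map (CL (proj₂ w)) (gadgetNbrs (proj₂ w))) _ _ ⟩
    profile (proj₂ w) (length (links w)) (pendantCount (proj₂ w)) ∎
    where
    w : Vertex n
    w = vertexOf u
    ns : List (Vertex n)
    ns = neighbours w
    pl : List (Fin m)
    pl = pendantsOf w
    old-old : ∀ y → α (u ↑ˡ m) (encode y ↑ˡ m) ≡ κ w y
    old-old y = trans (α-old-old u (encode y)) (cong (κ w) (decode-encode y))
    chain-part : map (α (u ↑ˡ m)) (map (_↑ˡ m) (map encode ns)) ≡ map (κ w) ns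
    chain-part = begin
      map (α (u ↑ˡ m)) (map (_↑ˡ m) (map encode ns)) ≡⟨ sym (map-∘ (map encode ns)) ⟩
      map (α (u ↑ˡ m) ∘ (_↑ˡ m)) (map encode ns)     ≡⟨ sym (map-∘ ns) ⟩
      map (α (u ↑ˡ m) ∘ (_↑ˡ m) ∘ encode) ns          ≡⟨ map-cong old-old ns ⟩
      map (κ w) ns ∎
    pendant-part : map (α (u ↑ˡ m)) (map (M ↑ʳ_) pl) ≡ replicate (pendantCount (proj₂ w)) pendantColour
    pendant-part = begin
      map (α (u ↑ˡ m)) (map (M ↑ʳ_) pl)  ≡⟨ sym (map-∘ pl) ⟩
      map (α (u ↑ˡ m) ∘ (M ↑ʳ_)) pl      ≡⟨ map-cong (α-old-new u) pl ⟩
      map (λ _ → pendantColour) pl      ≡⟨ map-const pendantColour pl ⟩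
      replicate (length pl) pendantColour ≡⟨ cong (λ k → replicate k pendantColour) (pendants-length w) ⟩
      replicate (pendantCount (proj₂ w)) pendantColour ∎

  attached : Adj (M + m)
  attached = attach (adj (chain n)) ps

  old-neighbourhood : ∀ u → Neighbourhood attached (u ↑ˡ m) (oldNbrs u)
  old-neighbourhood u = Pendants.old-neighbourhood (adj (chain n)) ps (chain-neighbourhood u) pendants-at
    where
    pendants-at : ∀ j → j ∈ pendantsOf (vertexOf u) ⇔ u ≡ lookup ps j
    pendants-at j = subst (λ w → j ∈ pendantsOf (vertexOf u) ⇔ w ≡ lookup ps j)
                          (encode-decode {n} u) (∈-pendantsOf (vertexOf u) j)

  module Rainbows (t : ℕ) (Shape : List ℕ → Set)
    (gadget-rainbow : ∀ a → All (λ k → Rainbow t Shape (profile a k (pendantCount a)))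
                                (upTo (suc (linkBound a))))
    (pendant-rainbow : Rainbow t Shape [ pendantColour ])
    where

    old-rainbow : ∀ u → Rainbow t Shape (map (α (u ↑ˡ m)) (oldNbrs u))
    old-rainbow u rewrite old-colours u =
      All.lookup (gadget-rainbow (proj₂ (vertexOf u))) (∈-upTo⁺ (s≤s (links-length (vertexOf u))))

    new-rainbow : ∀ j → Rainbow t Shape (map (α (M ↑ʳ j)) [ lookup ps j ↑ˡ m ])
    new-rainbow j rewrite α-new-old j (lookup ps j) = pendant-rainbow

    rainbow-star : ∀ v → Σ[ s ∈ Star attached t α v ] Shape (map (α v) (Star.nb s))
    rainbow-star v with side M v
    ... | old u = star attached {Shape = Shape} (oldNbrs u) (old-neighbourhood u) (old-rainbow u)
    ... | new j = star attached {Shape = Shape} [ lookup ps j ↑ˡ m ]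
                       (Pendants.new-neighbourhood (adj (chain n)) ps j) (new-rainbow j)

    proper : ProperColoring attached t α
    proper = stars⇒proper attached α-sym (proj₁ ∘ rainbow-star)

-- Colour tables are listed for a < b only and are 0 elsewhere, so taking a maximum symmetrises them.
symmetrise : (Label → Label → ℕ) → Label → Label → ℕ
symmetrise f a b = f a b ⊔ f b a

cyclicTable : Label → Label → ℕ
cyclicTable l0 l3 = 2
cyclicTable l0 l4 = 3
cyclicTable l0 l5 = 1
cyclicTable l1 l2 = 1
cyclicTable l1 l3 = 3
cyclicTable l1 l4 = 4
cyclicTable l2 l3 = 4
cyclicTable l2 l4 = 2
cyclicTable l5 l6 = 2
cyclicTable _ _ = 0

chain-cyclic-colourable : ∀ n → PendantCyclic (chain n) 0
chain-cyclic-colourable n = Vec.[] , 4 , α , proper , uncurry (star⇒cyclic attached) ∘ rainbow-star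
  where
  -- There are no pendant edges.
  open ChainColouring {n} (symmetrise cyclicTable) (λ a b → ⊔-comm (cyclicTable a b) _) 3 1 Vec.[]
         (λ _ → []) (λ _ ()) (λ _ → 0) (λ _ → refl)
  open Rainbows 4 (CyclicIntervalList 4)
         (toWitness {a? = all? λ a → All.all? (λ k → rainbow? 4 (cyclicIntervalList? 4) (profile a k 0))
                                                 (upTo (suc (linkBound a)))} _)
         (toWitness {a? = rainbow? 4 (cyclicIntervalList? 4) [ 1 ]} _)

intervalTable : Label → Label → ℕ
intervalTable l0 l3 = 2
intervalTable l0 l4 = 3
intervalTable l0 l5 = 1
intervalTable l1 l2 = 2
intervalTable l1 l3 = 3
intervalTable l1 l4 = 4
intervalTable l2 l3 = 4
intervalTable l2 l4 = 5
intervalTable l5 l6 = 2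
intervalTable _ _ = 0

module OnePendantPerGadget (n : ℕ) where

  pendantVertices : Vec (Fin (n * 7)) n
  pendantVertices = Vec.tabulate (λ i → encode (i , l2))

  pendantCount : Label → ℕ
  pendantCount a = if does (a ≟ l2) then 1 else 0

  pendantsOf : Vertex n → List (Fin n)
  pendantsOf (i , a) = if does (a ≟ l2) then [ i ] else []

  pendants-length : ∀ x → length (pendantsOf x) ≡ pendantCount (proj₂ x)
  pendants-length (i , a) with a ≟ l2
  ... | yes _ = refl
  ... | no _ = refl

  ∈-pendantsOf : ∀ x j → j ∈ pendantsOf x ⇔ encode x ≡ lookup pendantVertices j
  ∈-pendantsOf (i , a) j rewrite lookup∘tabulate (λ i → encode (i , l2)) j with a ≟ l2
  ... | yes refl = mk⇔ (λ { (here refl) → refl }) (here ∘ sym ∘ combine-injectiveˡ i l2 j l2)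
  ... | no a≢l2 = mk⇔ (λ ()) (λ eq → ⊥-elim (a≢l2 (combine-injectiveʳ i a j l2 eq)))

chain-interval-colourable : ∀ n → PendantInterval (chain n) n
chain-interval-colourable n = pendantVertices , 5 , α , proper , uncurry (star⇒interval attached) ∘ rainbow-star
  where
  open OnePendantPerGadget n
  open ChainColouring {n} (symmetrise intervalTable) (λ a b → ⊔-comm (intervalTable a b) _) 3 3
         pendantVertices pendantsOf ∈-pendantsOf pendantCount pendants-length
  open Rainbows 5 IntervalList
         (toWitness {a? = all? λ a → All.all? (λ k → rainbow? 5 intervalList? (profile a k (pendantCount a)))
                                                 (upTo (suc (linkBound a)))} _)
         (toWitness {a? = rainbow? 5 intervalList? [ 3 ]} _)

-- Every gadget needs a pendant edge at its core

coreLabels : List Label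
coreLabels = l0 ∷ l1 ∷ l2 ∷ l3 ∷ l4 ∷ []

gadgetNbrs-unique : ∀ a → Unique (gadgetNbrs a)
gadgetNbrs-unique = toWitness {a? = all? λ a → uniqueₗ? (gadgetNbrs a)} _

-- e23 and e24 are forced to be e14 and e13, and then e03 and e04 are both forced to be e12.
rainbow-core-forces : (e12 e13 e14 e23 e24 e03 e04 : Fin 3) →
                      Unique (e12 ∷ e13 ∷ e14 ∷ []) → Unique (e12 ∷ e23 ∷ e24 ∷ []) →
                      Unique (e03 ∷ e13 ∷ e23 ∷ []) → Unique (e04 ∷ e14 ∷ e24 ∷ []) → e03 ≡ e04
rainbow-core-forces = toWitness {a? =
  all? λ e12 → all? λ e13 → all? λ e14 → all? λ e23 → all? λ e24 → all? λ e03 → all? λ e04 →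
  unique₃? (e12 ∷ e13 ∷ e14 ∷ []) →-dec unique₃? (e12 ∷ e23 ∷ e24 ∷ []) →-dec
  unique₃? (e03 ∷ e13 ∷ e23 ∷ []) →-dec unique₃? (e04 ∷ e14 ∷ e24 ∷ []) →-dec e03 ≟ e04} _

module LowerBound {n m : ℕ} (ps : Vec (Fin (n * 7)) m)
                  {t : ℕ} {α : Fin (n * 7 + m) → Fin (n * 7 + m) → ℕ}
                  (colouring : IsIntervalColoring (attach (adj (chain n)) ps) t α) where

  attached : Adj (n * 7 + m)
  attached = attach (adj (chain n)) ps

  ι : Fin n → Label → Fin (n * 7 + m)
  ι i a = encode (i , a) ↑ˡ m

  OnCore : Fin n → Fin m → Set
  OnCore i j = proj₁ (decode {n} (lookup ps j)) ≡ i × proj₂ (decode {n} (lookup ps j)) ∈ coreLabels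

  module Bare (i : Fin n) (bare : ∀ j → ¬ OnCore i j) where

    no-pendant : ∀ a → a ∈ coreLabels → ∀ j → j ∈ [] ⇔ encode (i , a) ≡ lookup ps j
    no-pendant a a∈ j = mk⇔ (λ ())
      (λ eq → ⊥-elim (bare j (subst (λ w → proj₁ w ≡ i × proj₂ w ∈ coreLabels)
                                    (trans (sym (decode-encode (i , a))) (cong decode eq)) (refl , a∈))))

    core-neighbourhood : ∀ a → a ∈ coreLabels →
      Neighbourhood attached (ι i a) (map (_↑ˡ m) (map encode (neighbours (i , a))) ++ map (n * 7 ↑ʳ_) [])
    core-neighbourhood a a∈ =
      Pendants.old-neighbourhood (adj (chain n)) ps (chain-neighbourhood′ (i , a)) (no-pendant a a∈)

    ρ : Label → Label → Fin 3
    ρ a b = residue (α (ι i a) (ι i b))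

    ρ-sym : ∀ a b → b ∈ gadgetNbrs a → ρ a b ≡ ρ b a
    ρ-sym a b b∈ = cong residue (ProperColoring.symm (proj₁ colouring) (ι i a) (ι i b) edge)
      where
      edge : attached (ι i a) (ι i b) ≡ true
      edge = trans (Pendants.attach-old-old (adj (chain n)) ps (encode (i , a)) (encode (i , b)))
                   (from (chain-neighbourhood′ (i , a) (encode (i , b)))
                         (∈-map⁺ encode (∈-++⁺ˡ (∈-map⁺ (i ,_) b∈))))

    ι-injective : ∀ {b b′} → ι i b ≡ ι i b′ → b ≡ b′
    ι-injective eq = combine-injectiveʳ i _ i _ (↑ˡ-injective m _ _ eq)

    triangle : ∀ a b₁ b₂ b₃ → Neighbourhood attached (ι i a) (ι i b₁ ∷ ι i b₂ ∷ ι i b₃ ∷ []) →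
               Unique (b₁ ∷ b₂ ∷ b₃ ∷ []) →
               Unique (ρ a b₁ ∷ ρ a b₂ ∷ ρ a b₃ ∷ [])
    triangle a b₁ b₂ b₃ N labels =
      three-colour-residues (proj₂ colouring (ι i a)) (colours-at attached α N)
        (proper-rainbow attached (proj₁ colouring) (All.tabulate (from (N _)))
                        (Unique-map⁺ ι-injective labels))

    contradiction : ⊥
    contradiction = ρ03≢ρ04 (trans (ρ-sym l0 l3 (here refl))
                                   (trans (rainbow-core-forces _ _ _ _ _ _ _ R1 R2 R3 R4)
                                          (ρ-sym l4 l0 (here refl))))
      where
      R0 : Unique (ρ l0 l3 ∷ ρ l0 l4 ∷ ρ l0 l5 ∷ [])
      R0 = triangle l0 _ _ _ (core-neighbourhood l0 (here refl)) (gadgetNbrs-unique l0)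
      R1 : Unique (ρ l1 l2 ∷ ρ l1 l3 ∷ ρ l1 l4 ∷ [])
      R1 = triangle l1 _ _ _ (core-neighbourhood l1 (there (here refl))) (gadgetNbrs-unique l1)
      R2 : Unique (ρ l1 l2 ∷ ρ l2 l3 ∷ ρ l2 l4 ∷ [])
      R2 = subst (λ e → Unique (e ∷ ρ l2 l3 ∷ ρ l2 l4 ∷ [])) (ρ-sym l2 l1 (here refl))
                 (triangle l2 _ _ _ (core-neighbourhood l2 (there (there (here refl))))
                           (gadgetNbrs-unique l2))
      R3 : Unique (ρ l3 l0 ∷ ρ l1 l3 ∷ ρ l2 l3 ∷ [])
      R3 = subst₂ (λ e e′ → Unique (ρ l3 l0 ∷ e ∷ e′ ∷ []))
                  (ρ-sym l3 l1 (there (here refl))) (ρ-sym l3 l2 (there (there (here refl))))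
                  (triangle l3 _ _ _ (core-neighbourhood l3 (there (there (there (here refl)))))
                            (gadgetNbrs-unique l3))
      R4 : Unique (ρ l4 l0 ∷ ρ l1 l4 ∷ ρ l2 l4 ∷ [])
      R4 = subst₂ (λ e e′ → Unique (ρ l4 l0 ∷ e ∷ e′ ∷ []))
                  (ρ-sym l4 l1 (there (here refl))) (ρ-sym l4 l2 (there (there (here refl))))
                  (triangle l4 _ _ _ (core-neighbourhood l4 (there (there (there (there (here refl))))))
                            (gadgetNbrs-unique l4))
      ρ03≢ρ04 : ρ l0 l3 ≢ ρ l0 l4
      ρ03≢ρ04 with (ρ03≢ρ04 ∷ _) ∷ _ ← R0 = ρ03≢ρ04

  core-pendant : ∀ i → ∃[ j ] OnCore i j
  core-pendant i
    with any? (λ j → let (i′ , a) = decode {n} (lookup ps j) in i′ ≟ i ×-dec a ∈ₗ? coreLabels)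
  ... | yes found = found
  ... | no none = ⊥-elim (Bare.contradiction i (λ j onCore → none (j , onCore)))

  gadgets≤pendants : n ≤ m
  gadgets≤pendants = injective⇒≤ {f = proj₁ ∘ core-pendant} λ {i} {i′} eq →
    trans (sym (proj₁ (proj₂ (core-pendant i))))
          (trans (cong (λ j → proj₁ (decode {n} (lookup ps j))) eq) (proj₁ (proj₂ (core-pendant i′))))

chain-def-lower-bound : ∀ n m → PendantInterval (chain n) m → n ≤ m
chain-def-lower-bound n m (ps , t , α , colouring) = LowerBound.gadgets≤pendants ps colouring

-- Degree and connectivity

gadget-degree : ∀ a → length (gadgetNbrs a) + linkBound a ≤ 3
gadget-degree = toWitness {a? = all? λ a → length (gadgetNbrs a) + linkBound a ≤? 3} _

chain-max-degree : ∀ n → MaxDegreeAtMost (chain n) 3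
chain-max-degree n u = ≤-trans (degree≤ (chain n) (chain-neighbourhood {n} u)) (neighbours-length (decode u))
  where
  open ≤-Reasoning
  neighbours-length : ∀ (x : Vertex n) → length (map encode (neighbours x)) ≤ 3
  neighbours-length (i , a) = begin
    length (map encode (neighbours (i , a)))
      ≡⟨ length-map encode (neighbours (i , a)) ⟩
    length (map (i ,_) (gadgetNbrs a) ++ links (i , a))
      ≡⟨ length-++ (map (i ,_) (gadgetNbrs a)) ⟩
    length (map (i ,_) (gadgetNbrs a)) + length (links (i , a))
      ≤⟨ +-mono-≤ gadget-part (links-length (i , a)) ⟩
    length (gadgetNbrs a) + linkBound a
      ≤⟨ gadget-degree a ⟩
    3 ∎
    where
    gadget-part : length (map (i ,_) (gadgetNbrs a)) ≤ length (gadgetNbrs a)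
    gadget-part = ≤-reflexive (length-map (i ,_) (gadgetNbrs a))

module _ {G : Graph} where

  reach-trans : ∀ {u v w} → Reach G u v → Reach G v w → Reach G u w
  reach-trans here r = r
  reach-trans (step e r) r′ = step e (reach-trans r r′)

  reach-sym : ∀ {u v} → Reach G u v → Reach G v u
  reach-sym here = here
  reach-sym (step {u} {w} e r) = reach-trans (reach-sym r) (step (trans (Graph.sym G w u) e) here)

module _ {n : ℕ} where

  walk : ∀ (x y : Vertex n) {v} → y ∈ neighbours x →
         Reach (chain n) (encode y) v → Reach (chain n) (encode x) v
  walk x y y∈ = step (from (chain-neighbourhood′ x (encode y)) (∈-map⁺ encode y∈))

  walk-inside : ∀ i a b {v} → b ∈ gadgetNbrs a →
                Reach (chain n) (encode (i , b)) v → Reach (chain n) (encode (i , a)) v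
  walk-inside i a b b∈ = walk (i , a) (i , b) (∈-++⁺ˡ (∈-map⁺ (i ,_) b∈))

  to-l5 : ∀ i a → Reach (chain n) (encode (i , a)) (encode (i , l5))
  to-l5 i l0 = walk-inside i l0 l5 (there (there (here refl))) here
  to-l5 i l1 = walk-inside i l1 l3 (there (here refl)) (walk-inside i l3 l0 (here refl) (to-l5 i l0))
  to-l5 i l2 = walk-inside i l2 l3 (there (here refl)) (walk-inside i l3 l0 (here refl) (to-l5 i l0))
  to-l5 i l3 = walk-inside i l3 l0 (here refl) (to-l5 i l0)
  to-l5 i l4 = walk-inside i l4 l0 (here refl) (to-l5 i l0)
  to-l5 i l5 = here
  to-l5 i l6 = walk-inside i l6 l5 (here refl) here

  to-first : ∀ k (k<n : k < n) (0<n : 0 < n) →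
             Reach (chain n) (encode (fromℕ< k<n , l5)) (encode (fromℕ< 0<n , l5))
  to-first zero k<n 0<n = here
  to-first (suc k) k+1<n 0<n =
    walk (fromℕ< k+1<n , l5) (fromℕ< k<n , l6) (∈-++⁺ʳ _ (∈-map⁺ (_, l6) (from ∈-predecessor link)))
         (to-l5 _ l6 ⟨ reach-trans ⟩ to-first k k<n 0<n)
    where
    k<n : k < n
    k<n = <-trans (n<1+n k) k+1<n
    link : suc (toℕ (fromℕ< k<n)) ≡ toℕ (fromℕ< k+1<n)
    link = trans (cong suc (toℕ-fromℕ< k<n)) (sym (toℕ-fromℕ< k+1<n))

chain-connected : ∀ n → Connected (chain n)
chain-connected (suc n) u v = reach-trans (to-root u) (reach-sym (to-root v))
  where
  first : Fin (suc n)
  first = zero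
  to-root : ∀ u → Reach (chain (suc n)) u (encode (first , l5))
  to-root u with decode {suc n} u in eq
  ... | i , a = subst (λ w → Reach (chain (suc n)) w (encode (first , l5)))
                      (trans (cong encode (sym eq)) (encode-decode {suc n} u))
                      (to-l5 i a ⟨ reach-trans ⟩ l5-to-root)
    where
    l5-to-root : Reach (chain (suc n)) (encode (i , l5)) (encode (first , l5))
    l5-to-root = subst (λ j → Reach (chain (suc n)) (encode (j , l5)) (encode (first , l5)))
                       (fromℕ<-toℕ i (toℕ<n i)) (to-first (toℕ i) (toℕ<n i) (s≤s z≤n))

corollary2 : ∃[ D ] ((n : ℕ) → 1 ≤ n → ∃[ G ] (Connected G × MaxDegreeAtMost G D × ∃[ d ] ∃[ dc ] (IsDef G d × IsDefc G dc × dc + n ≤ d)))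
corollary2 = 3 , λ n _ →
  chain n , chain-connected n , chain-max-degree n , n , 0 ,
  (chain-interval-colourable n , chain-def-lower-bound n) ,
  (chain-cyclic-colourable n , λ _ _ → z≤n) ,
  ≤-refl
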